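{- There exist graphs $H_1$ and $H_2$ such that (i) $b_2(H_1)=4=b_2(H_1+K_2)$, and (ii) $b_2(H_2)=5=b_2(H_2+K_3)$.
   Context: $K_n$ is the complete graph on $n$ vertices and $G+H$ the disjoint union. An odd cover of a graph $G$ is a collection of complete bipartite graphs with disjoint parts $(X,Y)$, $X,Y\subseteq V(G)$, such that each edge of $G$ is covered (one endpoint in $X$, the other in $Y$) by an odd number of them and each nonedge by an even number; $b_2(G)$ is the minimum cardinality of an odd cover of $G$. -}

module Defs where

open import Data.Nat using (ℕ; _+_; _<_)
open import Data.Bool using (Bool; true; false; _∧_; _∨_; _xor_; not)
open import Data.Fin using (Fin; splitAt)
open import Data.Fin.Properties using (_≟_)
open import Data.Sum using (inj₁; inj₂)
open import Data.Product using (Σ; _×_; _,_; proj₁; proj₂)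
open import Data.Vec using (Vec; foldr; map)
open import Relation.Nullary using (¬_)
open import Relation.Nullary.Decidable using (⌊_⌋)
open import Relation.Binary.PropositionalEquality using (_≡_; _≢_; refl; sym)
open import Relation.Nullary using (yes; no)
open import Data.Empty using (⊥-elim)
open import Data.Vec.Membership.Propositional using (_∈_)

record Graph : Set where
  field
    n     : ℕ
    adj   : Fin n → Fin n → Bool
    adj-sym : ∀ u v → adj u v ≡ adj v u
    irref : ∀ v → adj v v ≡ false
open Graph public

K : ℕ → Graph
K m = record
  { n = m
  ; adj = λ u v → not ⌊ u ≟ v ⌋
  ; adj-sym = symK
  ; irref = irrefK
  }
  where
  symK : ∀ (u v : Fin m) → not ⌊ u ≟ v ⌋ ≡ not ⌊ v ≟ u ⌋
  symK u v with u ≟ v | v ≟ u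
  ... | yes _ | yes _ = refl
  ... | no _  | no _  = refl
  ... | yes p | no q  = ⊥-elim (q (sym p))
  ... | no p  | yes q = ⊥-elim (p (sym q))
  irrefK : ∀ (v : Fin m) → not ⌊ v ≟ v ⌋ ≡ false
  irrefK v with v ≟ v
  ... | yes _ = refl
  ... | no p  = ⊥-elim (p refl)

_⊕_ : Graph → Graph → Graph
G ⊕ H = record
  { n = n G + n H
  ; adj = a
  ; adj-sym = s
  ; irref = i
  }
  where
  a : Fin (n G + n H) → Fin (n G + n H) → Bool
  a u v with splitAt (n G) u | splitAt (n G) v
  ... | inj₁ x | inj₁ y = adj G x y
  ... | inj₂ x | inj₂ y = adj H x y
  ... | inj₁ _ | inj₂ _ = false
  ... | inj₂ _ | inj₁ _ = false
  s : ∀ u v → a u v ≡ a v u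
  s u v with splitAt (n G) u | splitAt (n G) v
  ... | inj₁ x | inj₁ y = adj-sym G x y
  ... | inj₂ x | inj₂ y = adj-sym H x y
  ... | inj₁ _ | inj₂ _ = refl
  ... | inj₂ _ | inj₁ _ = refl
  i : ∀ v → a v v ≡ false
  i v with splitAt (n G) v
  ... | inj₁ x = irref G x
  ... | inj₂ x = irref H x

-- A complete bipartite graph with parts (X , Y), X, Y ⊆ V(G) given as
-- characteristic functions.
Biclique : ℕ → Set
Biclique m = (Fin m → Bool) × (Fin m → Bool)

Disjoint : ∀ {m} → Biclique m → Set
Disjoint (X , Y) = ∀ v → (X v ∧ Y v) ≡ false

covers : ∀ {m} → Biclique m → Fin m → Fin m → Bool
covers (X , Y) u v = (X u ∧ Y v) ∨ (Y u ∧ X v)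

coverParity : ∀ {m k} → Vec (Biclique m) k → Fin m → Fin m → Bool
coverParity B u v = foldr _ _xor_ false (map (λ b → covers b u v) B)

OddCover : Graph → ℕ → Set
OddCover G k =
  Σ (Vec (Biclique (n G)) k) λ B →
    (∀ {b} → b ∈ B → Disjoint b) ×
    (∀ u v → u ≢ v → coverParity B u v ≡ adj G u v)

b₂≡ : Graph → ℕ → Set
b₂≡ G k = OddCover G k × (∀ m → m < k → ¬ OddCover G m)

-- An odd cover by k bicliques with disjoint parts is the same as a labelling of
-- the vertices by words of length k over {out, inX, inY} (one letter per
-- biclique) such that u ~ v iff the number of positions at which one word has
-- inX and the other inY is odd. The upper bounds are explicit labellings. For
-- the lower bounds an exhaustive search assigns words to the vertices one at a
-- time, pruning the candidate words of the remaining vertices by their parity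
-- with the placed ones, and finds no labelling with one letter fewer. It is
-- made feasible by symmetry breaking: swapping the parts of a biclique and
-- reordering the bicliques do not change the cover, so every cover has a
-- canonical form, and the search only explores canonical partial labellings.

module Submission where

open import Defs
open import Algebra.Bundles using (CommutativeRing)
open import Data.Bool using (Bool; true; false; not; T; _∧_; _∨_; _xor_; if_then_else_)
open import Data.Bool.ListAction using (any; all)
open import Data.Bool.Properties using (xor-∧-commutativeRing; T-∧)
import Data.Bool.Properties as Bool
open import Data.Fin using (Fin)
open import Data.Fin.Properties using (_≟_) renaming (all? to allFin?)
open import Data.List
  using (List; []; _∷_; _++_; map; foldr; zipWith; length; replicate; reverse; reverseAcc; null;
         filterᵇ; allFin; cartesianProductWith)
open import Data.List.Membership.Propositional using (_∈_)
open import Data.List.Membership.Propositional.Properties using (∈-cartesianProductWith⁺; ∈-filter⁺)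
open import Data.List.Properties using (map-++; length-map; map-∘; reverse-++; ʳ++-defn; length-reverse)
open import Data.List.Relation.Binary.Permutation.Propositional using (_↭_; ↭-sym; ↭⇒↭ₛ)
import Data.List.Relation.Binary.Permutation.Propositional.Properties as ↭
import Data.List.Relation.Binary.Permutation.Setoid.Properties as ↭ₛ
open import Data.List.Relation.Binary.Pointwise using (Pointwise; []; _∷_; reverse⁺)
import Data.List.Relation.Binary.Lex.NonStrict as Lex
open import Data.List.Relation.Unary.All using (All; all?)
import Data.List.Relation.Unary.All as All
import Data.List.Relation.Unary.All.Properties as All
open import Data.List.Relation.Unary.Any using (here; there)
import Data.List.Relation.Unary.Any as Any
open import Data.List.Relation.Unary.Any.Properties using (any⁺)
open import Data.List.Relation.Unary.Linked using (Linked; linked?)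
import Data.List.Relation.Unary.Linked as Linked
import Data.List.Relation.Unary.Linked.Properties as Linked
import Data.List.Sort
open import Data.Nat using (ℕ; zero; suc; _≤_; _≤′_; ≤′-refl; ≤′-step)
open import Data.Nat.Properties using (≤⇒≤′; ≤-pred; suc-injective)
import Data.Nat.Properties as ℕ
open import Data.Product using (Σ; _×_; _,_; proj₁; proj₂)
open import Data.Unit using (tt)
open import Data.Vec using (Vec; []; _∷_; toList; lookup)
import Data.Vec as Vec
open import Data.Vec.Membership.Propositional using () renaming (_∈_ to _∈ᵥ_)
open import Data.Vec.Properties using (length-toList)
open import Data.Vec.Functional using () renaming (_++_ to _++ᶠ_)
open import Data.Vec.Relation.Unary.Any using () renaming (here to hereᵥ; there to thereᵥ)
open import Function using (_∘_; id; _on_; Equivalence)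
open import Relation.Binary.Bundles using (DecTotalOrder)
import Relation.Binary.Construct.On as On
open import Relation.Binary.PropositionalEquality
open import Relation.Nullary using (yes; no; Dec; contradiction)
open import Relation.Nullary.Decidable using (⌊_⌋; _×-dec_; T?; fromWitness; toWitness)
open import Relation.Unary using (Decidable)

-- Roles, words and columns

data Role : Set where
  out inX inY : Role

Word : Set
Word = List Role

isOut isX isY : Role → Bool
isOut out = true
isOut _   = false
isX inX = true
isX _   = false
isY inY = true
isY _   = false

crosses : Role → Role → Bool
crosses inX inY = true
crosses inY inX = true
crosses _   _   = false

crosses-self : ∀ r → crosses r r ≡ false
crosses-self out = refl
crosses-self inX = refl
crosses-self inY = refl

crosses-sym : ∀ r s → crosses r s ≡ crosses s r
crosses-sym out out = refl
crosses-sym out inX = refl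
crosses-sym out inY = refl
crosses-sym inX out = refl
crosses-sym inX inX = refl
crosses-sym inX inY = refl
crosses-sym inY out = refl
crosses-sym inY inX = refl
crosses-sym inY inY = refl

swap : Role → Role
swap out = out
swap inX = inY
swap inY = inX

crosses-swap : ∀ r s → crosses (swap r) (swap s) ≡ crosses r s
crosses-swap out out = refl
crosses-swap out inX = refl
crosses-swap out inY = refl
crosses-swap inX out = refl
crosses-swap inX inX = refl
crosses-swap inX inY = refl
crosses-swap inY out = refl
crosses-swap inY inX = refl
crosses-swap inY inY = refl

crossParity : Word → Word → Bool
crossParity (r ∷ w) (s ∷ w′) = crosses r s xor crossParity w w′
crossParity _       _        = false

words : ℕ → List Word
words zero    = [] ∷ []
words (suc k) = cartesianProductWith _∷_ (out ∷ inX ∷ inY ∷ []) (words k)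

∈-words : ∀ w → w ∈ words (length w)
∈-words []      = here refl
∈-words (r ∷ w) = ∈-cartesianProductWith⁺ _∷_ (role∈ r) (∈-words w)
  where
  role∈ : ∀ r → r ∈ out ∷ inX ∷ inY ∷ []
  role∈ out = here refl
  role∈ inX = there (here refl)
  role∈ inY = there (there (here refl))

Column : ℕ → Set
Column N = Fin N → Role

module _ {N : ℕ} where

  row : List (Column N) → Fin N → Word
  row cs v = map (λ c → c v) cs

  restrict : List (Column N) → List (Fin N) → List Word
  restrict cs vs = map (λ c → map c vs) cs

  parity : List (Column N) → Fin N → Fin N → Bool
  parity cs u v = foldr _xor_ false (map (λ c → crosses (c u) (c v)) cs)

  crossParity-row : ∀ cs u v → crossParity (row cs u) (row cs v) ≡ parity cs u v
  crossParity-row []       u v = refl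
  crossParity-row (c ∷ cs) u v = cong (crosses (c u) (c v) xor_) (crossParity-row cs u v)

  parity-self : ∀ cs v → parity cs v v ≡ false
  parity-self []       v = refl
  parity-self (c ∷ cs) v rewrite crosses-self (c v) = parity-self cs v

  parity-sym : ∀ cs u v → parity cs u v ≡ parity cs v u
  parity-sym []       u v = refl
  parity-sym (c ∷ cs) u v = cong₂ _xor_ (crosses-sym (c u) (c v)) (parity-sym cs u v)

  parity-map : ∀ (f : Column N → Column N) {u v} →
               (∀ c → crosses (f c u) (f c v) ≡ crosses (c u) (c v)) →
               ∀ cs → parity (map f cs) u v ≡ parity cs u v
  parity-map f f-crosses []       = refl
  parity-map f f-crosses (c ∷ cs) = cong₂ _xor_ (f-crosses c) (parity-map f f-crosses cs)

  parity-↭ : ∀ {cs ds} → cs ↭ ds → ∀ u v → parity cs u v ≡ parity ds u v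
  parity-↭ cs↭ds u v =
    ↭ₛ.foldr-commMonoid (setoid Bool) +-isCommutativeMonoid (↭⇒↭ₛ (↭.map⁺ _ cs↭ds))
    where open CommutativeRing xor-∧-commutativeRing using (+-isCommutativeMonoid)

  role : Biclique N → Column N
  role (X , Y) v = if X v then inX else if Y v then inY else out

  biclique : Column N → Biclique N
  biclique c = (λ v → isX (c v)) , (λ v → isY (c v))

  biclique-disjoint : ∀ c → Disjoint (biclique c)
  biclique-disjoint c v with c v
  ... | out = refl
  ... | inX = refl
  ... | inY = refl

  covers-biclique : ∀ c u v → covers (biclique c) u v ≡ crosses (c u) (c v)
  covers-biclique c u v with c u | c v
  ... | out | _   = refl
  ... | inX | out = refl
  ... | inX | inX = refl
  ... | inX | inY = refl
  ... | inY | out = refl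
  ... | inY | inX = refl
  ... | inY | inY = refl

  biclique-role : ∀ b → Disjoint b → ∀ v →
                  proj₁ b v ≡ proj₁ (biclique (role b)) v × proj₂ b v ≡ proj₂ (biclique (role b)) v
  biclique-role (X , Y) disjoint v with X v | Y v | disjoint v
  ... | true  | false | _ = refl , refl
  ... | false | true  | _ = refl , refl
  ... | false | false | _ = refl , refl

  covers-role : ∀ b → Disjoint b → ∀ u v → covers b u v ≡ crosses (role b u) (role b v)
  covers-role b disjoint u v =
    trans (cong₂ _∨_ (cong₂ _∧_ (proj₁ (recover u)) (proj₂ (recover v)))
                     (cong₂ _∧_ (proj₂ (recover u)) (proj₁ (recover v))))
          (covers-biclique (role b) u v)
    where recover = biclique-role b disjoint

  coverParity-bicliques : ∀ {k} (cs : Vec (Column N) k) u v →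
                          coverParity (Vec.map biclique cs) u v ≡ parity (toList cs) u v
  coverParity-bicliques []       u v = refl
  coverParity-bicliques (c ∷ cs) u v = cong₂ _xor_ (covers-biclique c u v) (coverParity-bicliques cs u v)

  coverParity-roles : ∀ {k} (B : Vec (Biclique N) k) → (∀ {b} → b ∈ᵥ B → Disjoint b) →
                      ∀ u v → coverParity B u v ≡ parity (toList (Vec.map role B)) u v
  coverParity-roles []      _        u v = refl
  coverParity-roles (b ∷ B) disjoint u v =
    cong₂ _xor_ (covers-role b (disjoint (hereᵥ refl)) u v) (coverParity-roles B (disjoint ∘ thereᵥ) u v)

-- Odd covers as role columns

Realises : ∀ {N} → (Fin N → Fin N → Bool) → List (Column N) → Set
Realises A cs = ∀ u v → parity cs u v ≡ A u v

realises? : ∀ {N} (A : Fin N → Fin N → Bool) cs → Dec (Realises A cs)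
realises? A cs = allFin? λ u → allFin? λ v → parity cs u v Bool.≟ A u v

module _ (G : Graph) where

  oddCover⇒columns : ∀ {k} → OddCover G k →
                     Σ (List (Column (n G))) λ cs → length cs ≡ k × Realises (adj G) cs
  oddCover⇒columns (B , disjoint , odd) = cs , length-toList (Vec.map role B) , realises
    where
    cs = toList (Vec.map role B)
    realises : Realises (adj G) cs
    realises u v with u ≟ v
    ... | yes refl = trans (parity-self cs u) (sym (irref G u))
    ... | no  u≢v  = trans (sym (coverParity-roles B disjoint u v)) (odd u v u≢v)

  columns⇒oddCover : ∀ {k} (cs : Vec (Column (n G)) k) → Realises (adj G) (toList cs) → OddCover G k
  columns⇒oddCover cs realises =
    Vec.map biclique cs , disjoint cs , λ u v _ → trans (coverParity-bicliques cs u v) (realises u v)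
    where
    disjoint : ∀ {k} (cs : Vec (Column (n G)) k) {b} → b ∈ᵥ Vec.map biclique cs → Disjoint b
    disjoint (c ∷ _)  (hereᵥ refl) = biclique-disjoint c
    disjoint (_ ∷ cs) (thereᵥ b∈)  = disjoint cs b∈

  oddCover-suc : ∀ {k} → OddCover G k → OddCover G (suc k)
  oddCover-suc (B , disjoint , odd) = ((λ _ → false) , (λ _ → false)) ∷ B , disjoint′ , odd
    where
    disjoint′ : ∀ {b} → b ∈ᵥ _ ∷ B → Disjoint b
    disjoint′ (hereᵥ refl) v = refl
    disjoint′ (thereᵥ b∈)    = disjoint b∈

  oddCover-≤ : ∀ {m k} → m ≤ k → OddCover G m → OddCover G k
  oddCover-≤ m≤k = go (≤⇒≤′ m≤k)
    where
    go : ∀ {m k} → m ≤′ k → OddCover G m → OddCover G k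
    go ≤′-refl        = id
    go (≤′-step m≤′k) = oddCover-suc ∘ go m≤′k

-- Canonical covers

lastNonOut : Word → Role
lastNonOut []      = out
lastNonOut (r ∷ w) = if isOut (lastNonOut w) then r else lastNonOut w

lastNonOut-++ : ∀ w′ w → isOut (lastNonOut w) ≡ false → lastNonOut (w′ ++ w) ≡ lastNonOut w
lastNonOut-++ []       w h = refl
lastNonOut-++ (r ∷ w′) w h rewrite lastNonOut-++ w′ w h | h = refl

lastNonOut-map-swap : ∀ w → lastNonOut (map swap w) ≡ swap (lastNonOut w)
lastNonOut-map-swap []      = refl
lastNonOut-map-swap (r ∷ w) rewrite lastNonOut-map-swap w with lastNonOut w
... | out = refl
... | inX = refl
... | inY = refl

lastNonOut-allOut : ∀ w → T (all isOut w) → lastNonOut w ≡ out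
lastNonOut-allOut []        _ = refl
lastNonOut-allOut (out ∷ w) h rewrite lastNonOut-allOut w h = refl

Normal : Word → Set
Normal w = isY (lastNonOut w) ≡ false

normal-++⁻ : ∀ w′ w → Normal (w′ ++ w) → Normal w
normal-++⁻ w′ w h with lastNonOut w in eq
... | out = refl
... | inX = refl
... | inY = trans (sym (cong isY (trans (lastNonOut-++ w′ w (cong isOut eq)) eq))) h

rank : Role → ℕ
rank out = 0
rank inX = 1
rank inY = 2

roleOrder : DecTotalOrder _ _ _
roleOrder = On.decTotalOrder ℕ.≤-decTotalOrder rank

wordOrder : DecTotalOrder _ _ _
wordOrder = Lex.≤-decTotalOrder roleOrder

open DecTotalOrder roleOrder using ()
  renaming (_≤_ to _≤ᵣ_; _≤?_ to _≤ᵣ?_; reflexive to ≤ᵣ-reflexive)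
open DecTotalOrder wordOrder using ()
  renaming (_≈_ to _≋_; _≤_ to _≼_; _≟_ to _≋?_)

≼-++⁻ : ∀ {w₁ w₂} w₁′ w₂′ → length w₁ ≡ length w₂ → w₁ ++ w₁′ ≼ w₂ ++ w₂′ → w₁ ≼ w₂
≼-++⁻ {[]}     {[]}     _ _ _  _                  = Lex.base tt
≼-++⁻ {_ ∷ _}  {_ ∷ _}  _ _ _  (Lex.this r<s)     = Lex.this r<s
≼-++⁻ {_ ∷ w₁} {_ ∷ w₂} _ _ eq (Lex.next r≈s rest) = Lex.next r≈s (≼-++⁻ _ _ (suc-injective eq) rest)

≼-++-∷⁻ : ∀ {p p′ r s w w′} → p ≋ p′ → p ++ r ∷ w ≼ p′ ++ s ∷ w′ → r ≤ᵣ s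
≼-++-∷⁻ []           (Lex.this (r≤s , _))  = r≤s
≼-++-∷⁻ []           (Lex.next r≈s _)      = ≤ᵣ-reflexive r≈s
≼-++-∷⁻ (x≈y ∷ p≋p′) (Lex.this (_ , x≉y)) = contradiction x≈y x≉y
≼-++-∷⁻ (_   ∷ p≋p′) (Lex.next _ rest)     = ≼-++-∷⁻ p≋p′ rest

infix 4 _⊑_

_⊑_ : Word → Word → Set _
_⊑_ = _≼_ on reverse

⊑-++⁻ : ∀ {w₁ w₂} w₁′ w₂′ → length w₁ ≡ length w₂ → w₁′ ++ w₁ ⊑ w₂′ ++ w₂ → w₁ ⊑ w₂
⊑-++⁻ {w₁} {w₂} w₁′ w₂′ eq h =
  ≼-++⁻ (reverse w₁′) (reverse w₂′)
        (trans (length-reverse w₁) (trans eq (sym (length-reverse w₂))))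
        (subst₂ _≼_ (reverse-++ w₁′ w₁) (reverse-++ w₂′ w₂) h)

-- The search places vertices one at a time and conses each onto the partial
-- columns, so a partial column is a suffix of the final one; both conditions
-- are therefore read from the end of the word, which makes them suffix-closed.
Canonical : List Word → Set _
Canonical S = All Normal S × Linked _⊑_ S

module _ {N : ℕ} where

  canonical-restrict-++⁻ : ∀ cs (vs′ vs : List (Fin N)) →
                           Canonical (restrict cs (vs′ ++ vs)) → Canonical (restrict cs vs)
  canonical-restrict-++⁻ cs vs′ vs (normal , sorted) =
    All.map⁺ (All.map normal-suffix (All.map⁻ normal)) ,
    Linked.map⁺ (Linked.map ⊑-suffix (Linked.map⁻ sorted))
    where
    normal-suffix : ∀ {c} → Normal (map c (vs′ ++ vs)) → Normal (map c vs)
    normal-suffix {c} h = normal-++⁻ (map c vs′) (map c vs) (subst Normal (map-++ c vs′ vs) h)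
    ⊑-suffix : ∀ {c d} → map c (vs′ ++ vs) ⊑ map d (vs′ ++ vs) → map c vs ⊑ map d vs
    ⊑-suffix {c} {d} h =
      ⊑-++⁻ (map c vs′) (map d vs′) (trans (length-map c vs) (sym (length-map d vs)))
            (subst₂ _⊑_ (map-++ c vs′ vs) (map-++ d vs′ vs) h)

module _ {N : ℕ} (vs : List (Fin N)) where

  normalise : Column N → Column N
  normalise c = if isY (lastNonOut (map c vs)) then swap ∘ c else c

  normal-normalise : ∀ c → Normal (map (normalise c) vs)
  normal-normalise c with isY (lastNonOut (map c vs)) in eq
  ... | false = eq
  ... | true  rewrite map-∘ {g = swap} {f = c} vs | lastNonOut-map-swap (map c vs)
    with lastNonOut (map c vs)
  ... | inY = refl

  crosses-normalise : ∀ c u v → crosses (normalise c u) (normalise c v) ≡ crosses (c u) (c v)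
  crosses-normalise c u v with isY (lastNonOut (map c vs))
  ... | true  = crosses-swap (c u) (c v)
  ... | false = refl

  open Data.List.Sort (On.decTotalOrder wordOrder (λ c → reverse (map c vs))) using (sort; sort-↭; sort-↗)

  canonise : List (Column N) → List (Column N)
  canonise cs = sort (map normalise cs)

  length-canonise : ∀ cs → length (canonise cs) ≡ length cs
  length-canonise cs = trans (↭.↭-length (sort-↭ _)) (length-map normalise cs)

  parity-canonise : ∀ cs u v → parity (canonise cs) u v ≡ parity cs u v
  parity-canonise cs u v =
    trans (parity-↭ (sort-↭ _) u v) (parity-map normalise (λ c → crosses-normalise c u v) cs)

  canonical-canonise : ∀ cs → Canonical (restrict (canonise cs) vs)
  canonical-canonise cs =
    All.map⁺ (↭.All-resp-↭ (↭-sym (sort-↭ _)) (All.map⁺ (All.universal normal-normalise cs))) ,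
    Linked.map⁺ (sort-↗ _)

headNormal : Word → Bool
headNormal []      = true
headNormal (r ∷ t) = not (all isOut t) ∨ not (isY r)

headsOrdered : Word → Word → Bool
headsOrdered (r ∷ t) (s ∷ t′) = not ⌊ t ≋? t′ ⌋ ∨ ⌊ r ≤ᵣ? s ⌋
headsOrdered _       _        = true

-- What can fail when a row is added to canonical columns; the search decides
-- this instead of Canonical because it only inspects the newest entries.
LocallyCanonical : List Word → Set
LocallyCanonical S = All (T ∘ headNormal) S × Linked (λ w w′ → T (headsOrdered w w′)) S

locallyCanonical? : Decidable LocallyCanonical
locallyCanonical? S = all? (T? ∘ headNormal) S ×-dec linked? (λ w w′ → T? (headsOrdered w w′)) S

normal⇒headNormal : ∀ {w} → Normal w → T (headNormal w)
normal⇒headNormal {[]}    _ = tt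
normal⇒headNormal {r ∷ t} h with all isOut t in allOut
... | false = tt
... | true rewrite lastNonOut-allOut t (subst T (sym allOut) tt) = subst (T ∘ not) (sym h) tt

⊑⇒headsOrdered : ∀ {w w′} → w ⊑ w′ → T (headsOrdered w w′)
⊑⇒headsOrdered {[]}    {_}      _ = tt
⊑⇒headsOrdered {_ ∷ _} {[]}     _ = tt
⊑⇒headsOrdered {r ∷ t} {s ∷ t′} h with t ≋? t′
... | no  _    = tt
... | yes t≋t′ = fromWitness (≼-++-∷⁻ (reverse⁺ t≋t′)
                   (subst₂ _≼_ (ʳ++-defn t) (ʳ++-defn t′) h))

canonical⇒locallyCanonical : ∀ {S} → Canonical S → LocallyCanonical S
canonical⇒locallyCanonical (normal , sorted) =
  All.map (λ {w} → normal⇒headNormal {w}) normal , Linked.map (λ {w w′} → ⊑⇒headsOrdered {w} {w′}) sorted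

-- The search

addRow : Word → List Word → List Word
addRow = zipWith _∷_

addRow-restrict : ∀ {N} (cs : List (Column N)) w done →
                  addRow (row cs w) (restrict cs done) ≡ restrict cs (w ∷ done)
addRow-restrict []       w done = refl
addRow-restrict (c ∷ cs) w done = cong ((c w ∷ map c done) ∷_) (addRow-restrict cs w done)

restrict-[] : ∀ {N} (cs : List (Column N)) → restrict cs [] ≡ replicate (length cs) []
restrict-[] []       = refl
restrict-[] (c ∷ cs) = cong ([] ∷_) (restrict-[] cs)

module Search {N : ℕ} (A : Fin N → Fin N → Bool) where

  -- Matching on the required parity before filtering makes A w v be evaluated
  -- once per pair of vertices rather than once per candidate word.
  consistentWith : Word → Bool → List Word → List Word
  consistentWith l true  = filterᵇ (crossParity l)
  consistentWith l false = filterᵇ (not ∘ crossParity l)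

  prune : Fin N → Word → List (Fin N) → List (List Word) → List (List Word)
  prune w l (v ∷ vs) (ls ∷ lss) = consistentWith l (A w v) ls ∷ prune w l vs lss
  prune w l _        _          = []

  mutual
    extendable : List (Fin N) → List (List Word) → List Word → Bool
    extendable []       _          S = true
    extendable (_ ∷ _)  []         S = false
    extendable (w ∷ vs) (ls ∷ lss) S = any (λ l → viable vs (prune w l vs lss) (addRow l S)) ls

    viable : List (Fin N) → List (List Word) → List Word → Bool
    viable vs lss S = ⌊ locallyCanonical? S ⌋ ∧ all (not ∘ null) lss ∧ extendable vs lss S

  search : ℕ → Bool
  search k = extendable (allFin N) (map (λ _ → words k) (allFin N)) (replicate k [])

module _ {N : ℕ} {A : Fin N → Fin N → Bool} (cs : List (Column N)) (realises : Realises A cs) where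
  open Search A

  RowsIn : List (Fin N) → List (List Word) → Set
  RowsIn = Pointwise (λ v ls → row cs v ∈ ls)

  ∈-consistentWith : ∀ {l l′ ls} b → l′ ∈ ls → crossParity l l′ ≡ b → l′ ∈ consistentWith l b ls
  ∈-consistentWith true  l′∈ls eq = ∈-filter⁺ (T? ∘ _) l′∈ls (subst T (sym eq) tt)
  ∈-consistentWith false l′∈ls eq = ∈-filter⁺ (T? ∘ _) l′∈ls (subst (T ∘ not) (sym eq) tt)

  prune-RowsIn : ∀ w {vs lss} → RowsIn vs lss → RowsIn vs (prune w (row cs w) vs lss)
  prune-RowsIn w []                       = []
  prune-RowsIn w (_∷_ {x = v} row∈ rowsIn) =
    ∈-consistentWith (A w v) row∈ (trans (crossParity-row cs w v) (realises w v)) ∷ prune-RowsIn w rowsIn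

  RowsIn⇒nonEmpty : ∀ {vs lss} → RowsIn vs lss → T (all (not ∘ null) lss)
  RowsIn⇒nonEmpty []               = tt
  RowsIn⇒nonEmpty (here  _ ∷ rest) = RowsIn⇒nonEmpty rest
  RowsIn⇒nonEmpty (there _ ∷ rest) = RowsIn⇒nonEmpty rest

  mutual
    extendable-complete : ∀ done vs lss → RowsIn vs lss → Canonical (restrict cs (reverseAcc done vs)) →
                          T (extendable vs lss (restrict cs done))
    extendable-complete done []       []         []              _         = tt
    extendable-complete done (w ∷ vs) (ls ∷ lss) (row∈ ∷ rowsIn) canonical =
      any⁺ _ (Any.map (λ { refl → step }) row∈)
      where
      step : T (viable vs (prune w (row cs w) vs lss) (addRow (row cs w) (restrict cs done)))
      step rewrite addRow-restrict cs w done =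
        viable-complete (w ∷ done) vs _ (prune-RowsIn w rowsIn) canonical

    viable-complete : ∀ done vs lss → RowsIn vs lss → Canonical (restrict cs (reverseAcc done vs)) →
                      T (viable vs lss (restrict cs done))
    viable-complete done vs lss rowsIn canonical =
      Equivalence.from T-∧ (fromWitness {a? = locallyCanonical? _} (canonical⇒locallyCanonical canonical-done) ,
        Equivalence.from T-∧ (RowsIn⇒nonEmpty rowsIn , extendable-complete done vs lss rowsIn canonical))
      where
      canonical-done : Canonical (restrict cs done)
      canonical-done =
        canonical-restrict-++⁻ cs (reverse vs) done (subst (Canonical ∘ restrict cs) (ʳ++-defn vs) canonical)

  RowsIn-words : ∀ vs → RowsIn vs (map (λ _ → words (length cs)) vs)
  RowsIn-words []       = []
  RowsIn-words (v ∷ vs) =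
    subst (λ k → row cs v ∈ words k) (length-map _ cs) (∈-words (row cs v)) ∷ RowsIn-words vs

  search-complete : Canonical (restrict cs (reverse (allFin N))) → T (search (length cs))
  search-complete canonical =
    subst (T ∘ extendable (allFin N) _) (restrict-[] cs)
          (extendable-complete [] (allFin N) _ (RowsIn-words (allFin N)) canonical)

oddCover⇒search : ∀ G {k} → OddCover G k → T (Search.search (adj G) k)
oddCover⇒search G cover with oddCover⇒columns G cover
... | cs , refl , realises =
  subst (T ∘ Search.search (adj G)) (length-canonise ord cs)
        (search-complete (canonise ord cs) realises′ (canonical-canonise ord cs))
  where
  ord = reverse (allFin (n G))
  realises′ : Realises (adj G) (canonise ord cs)
  realises′ u v = trans (parity-canonise ord cs u v) (realises u v)

b₂≡-suc : ∀ G {k} (cs : Vec (Column (n G)) (suc k)) → Realises (adj G) (toList cs) →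
          Search.search (adj G) k ≡ false → b₂≡ G (suc k)
b₂≡-suc G cs realises noCover =
  columns⇒oddCover G cs realises ,
  λ m m<1+k cover → subst T noCover (oddCover⇒search G (oddCover-≤ G (≤-pred m<1+k) cover))

-- The graphs

realisedGraph : ∀ {N k} → Vec (Column N) k → Graph
realisedGraph {N} cs = record
  { n = N ; adj = parity (toList cs) ; adj-sym = parity-sym (toList cs) ; irref = parity-self (toList cs) }

columns₁ : Vec (Column 10) 4
columns₁ = Vec.map lookup
  ( (inY ∷ inX ∷ inY ∷ inY ∷ inX ∷ inY ∷ out ∷ inX ∷ out ∷ inX ∷ [])
  ∷ (out ∷ inY ∷ out ∷ out ∷ inX ∷ inX ∷ out ∷ out ∷ inX ∷ inX ∷ [])
  ∷ (out ∷ inX ∷ inY ∷ inY ∷ inY ∷ inX ∷ inY ∷ inX ∷ inX ∷ out ∷ [])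
  ∷ (inY ∷ inY ∷ inX ∷ out ∷ inY ∷ inY ∷ inY ∷ out ∷ out ∷ out ∷ [])
  ∷ [])

columnsK₂ : Vec (Column 2) 4
columnsK₂ = Vec.map lookup
  ( (inX ∷ inY ∷ [])
  ∷ (inX ∷ inY ∷ [])
  ∷ (inX ∷ inY ∷ [])
  ∷ (inX ∷ out ∷ [])
  ∷ [])

columns₂ : Vec (Column 16) 5
columns₂ = Vec.map lookup
  ( (inY ∷ inY ∷ inX ∷ inY ∷ inY ∷ inX ∷ out ∷ inX ∷ inY ∷ inY ∷ out ∷ out ∷ inY ∷ inY ∷ inX ∷ out ∷ [])
  ∷ (out ∷ inY ∷ inY ∷ inY ∷ inX ∷ out ∷ inX ∷ inX ∷ inX ∷ inX ∷ inY ∷ inX ∷ inY ∷ out ∷ inX ∷ inY ∷ [])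
  ∷ (inX ∷ inX ∷ inY ∷ out ∷ out ∷ out ∷ out ∷ inY ∷ inX ∷ inY ∷ inY ∷ inY ∷ inX ∷ inY ∷ out ∷ inX ∷ [])
  ∷ (inY ∷ out ∷ inX ∷ inX ∷ inY ∷ out ∷ inX ∷ inY ∷ inY ∷ inX ∷ inX ∷ inY ∷ inX ∷ out ∷ inX ∷ inY ∷ [])
  ∷ (inY ∷ inX ∷ inY ∷ inY ∷ inX ∷ out ∷ out ∷ inX ∷ inY ∷ out ∷ inY ∷ inX ∷ inX ∷ out ∷ out ∷ out ∷ [])
  ∷ [])

columnsK₃ : Vec (Column 3) 5
columnsK₃ = Vec.map lookup
  ( (inX ∷ out ∷ out ∷ [])
  ∷ (inX ∷ out ∷ inX ∷ [])
  ∷ (inX ∷ inY ∷ inY ∷ [])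
  ∷ (inX ∷ inX ∷ out ∷ [])
  ∷ (out ∷ inY ∷ inX ∷ [])
  ∷ [])

H₁ H₂ : Graph
H₁ = realisedGraph columns₁
H₂ = realisedGraph columns₂

columns₁⊕K₂ : Vec (Column 12) 4
columns₁⊕K₂ = Vec.zipWith _++ᶠ_ columns₁ columnsK₂

columns₂⊕K₃ : Vec (Column 19) 5
columns₂⊕K₃ = Vec.zipWith _++ᶠ_ columns₂ columnsK₃

realises₁⊕K₂ : Realises (adj (H₁ ⊕ K 2)) (toList columns₁⊕K₂)
realises₁⊕K₂ = toWitness {a? = realises? (adj (H₁ ⊕ K 2)) (toList columns₁⊕K₂)} tt

realises₂⊕K₃ : Realises (adj (H₂ ⊕ K 3)) (toList columns₂⊕K₃)
realises₂⊕K₃ = toWitness {a? = realises? (adj (H₂ ⊕ K 3)) (toList columns₂⊕K₃)} tt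

proposition9 : Σ Graph (λ H₁ → b₂≡ H₁ 4 × b₂≡ (H₁ ⊕ K 2) 4)
               × Σ Graph (λ H₂ → b₂≡ H₂ 5 × b₂≡ (H₂ ⊕ K 3) 5)
proposition9 =
  (H₁ , b₂≡-suc H₁ columns₁ (λ _ _ → refl) refl
      , b₂≡-suc (H₁ ⊕ K 2) columns₁⊕K₂ realises₁⊕K₂ refl) ,
  (H₂ , b₂≡-suc H₂ columns₂ (λ _ _ → refl) refl
      , b₂≡-suc (H₂ ⊕ K 3) columns₂⊕K₃ realises₂⊕K₃ refl)
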